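{- For all integers $n,k\ge 2$, \[ c(n,k)\le (k-1)^n\,2^{\binom{n}{2}}. \]
   Context: An edge coloring of $K_n$ is a Gallai coloring if it contains no triangle whose three edges have three distinct colors. The vertices of $K_n$ are labeled, and $c(n,k)$ denotes the number of Gallai colorings $E(K_n)\to[k]=\{1,\dots,k\}$ (not all $k$ colors need be used). -}

module Defs where

open import Data.Nat using (ℕ; zero; suc)
open import Data.Fin using (Fin) renaming (_≟_ to _≟ᶠ_)
open import Data.Fin.Properties using (all?)
open import Data.Maybe using (Maybe; just; nothing)
open import Data.Maybe.Properties using (≡-dec)
open import Data.Vec using (Vec; []; _∷_; lookup)
open import Data.List using (List; []; _∷_; map; concatMap; filter; length)
open import Data.Product using (_×_; _,_)
open import Relation.Nullary using (¬_; Dec)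
open import Relation.Nullary.Decidable using (_×-dec_; _→-dec_; ¬?)
open import Relation.Binary.PropositionalEquality using (_≡_; _≢_)

allVecs : ∀ {a} {A : Set a} → List A → (m : ℕ) → List (Vec A m)
allVecs xs zero = [] ∷ []
allVecs xs (suc m) = concatMap (λ x → map (x ∷_) (allVecs xs m)) xs

allFin : (k : ℕ) → List (Fin k)
allFin zero = []
allFin (suc k) = Fin.zero ∷ map Fin.suc (allFin k)

allMaybeFin : (k : ℕ) → List (Maybe (Fin k))
allMaybeFin k = nothing ∷ map just (allFin k)

-- A (candidate) edge colouring of K_n with colours in [k] is encoded as an
-- n×n matrix with entries in Maybe (Fin k): entry (i,j) is the colour of the
-- edge {i,j}; the diagonal (non-edges) carries 'nothing'.
Matrix : ℕ → ℕ → Set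
Matrix n k = Vec (Vec (Maybe (Fin k)) n) n

col : ∀ {n k} → Matrix n k → Fin n → Fin n → Maybe (Fin k)
col M i j = lookup (lookup M i) j

-- M encodes an edge colouring E(K_n) → [k]: symmetric, 'nothing' exactly on
-- the diagonal.  Such matrices are in bijection with maps E(K_n) → Fin k.
IsEdgeColouring : ∀ {n k} → Matrix n k → Set
IsEdgeColouring {n} M =
  ∀ (i j : Fin n) →
    (col M i j ≡ col M j i) × ((i ≡ j → col M i j ≡ nothing) × (col M i j ≡ nothing → i ≡ j))

RainbowTriangle : ∀ {n k} → Matrix n k → Fin n → Fin n → Fin n → Set
RainbowTriangle M a b c =
  (a ≢ b) × (b ≢ c) × (a ≢ c) ×
  (col M a b ≢ col M b c) × (col M b c ≢ col M a c) × (col M a b ≢ col M a c)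

IsGallai : ∀ {n k} → Matrix n k → Set
IsGallai {n} M = ∀ (a b c : Fin n) → ¬ RainbowTriangle M a b c

IsGallaiColouring : ∀ {n k} → Matrix n k → Set
IsGallaiColouring M = IsEdgeColouring M × IsGallai M

isGallaiColouring? : ∀ {n k} (M : Matrix n k) → Dec (IsGallaiColouring M)
isGallaiColouring? {n} {k} M = edge? ×-dec gallai?
  where
  _≟ᵐ_ = ≡-dec {A = Fin k} _≟ᶠ_
  edge? = all? λ i → all? λ j →
    (col M i j ≟ᵐ col M j i) ×-dec
    (((i ≟ᶠ j) →-dec (col M i j ≟ᵐ nothing)) ×-dec
     ((col M i j ≟ᵐ nothing) →-dec (i ≟ᶠ j)))
  gallai? = all? λ a → all? λ b → all? λ c → ¬?
    (¬? (a ≟ᶠ b) ×-dec ¬? (b ≟ᶠ c) ×-dec ¬? (a ≟ᶠ c) ×-dec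
     ¬? (col M a b ≟ᵐ col M b c) ×-dec ¬? (col M b c ≟ᵐ col M a c) ×-dec
     ¬? (col M a b ≟ᵐ col M a c))

allMatrices : (n k : ℕ) → List (Matrix n k)
allMatrices n k = allVecs (allVecs (allMaybeFin k) n) n

-- c(n,k): the number of Gallai colourings E(K_n) → [k] (labelled vertices).
gallaiCount : ℕ → ℕ → ℕ
gallaiCount n k = length (filter isGallaiColouring? (allMatrices n k))

-- A colouring of K_(n+1) is a colouring of K_n on the vertices 1, …, n together with the row of
-- colours of the edges at vertex 0, and a Gallai colouring arises from a Gallai colouring of K_n
-- and a row creating no rainbow triangle through vertex 0. Bound the number E m of such rows for
-- m old vertices, k = j + 2 colours: write the new row as a ∷ r and let s be the row of the old
-- first vertex. Then r is such a row for the colouring without that vertex, and the colour a takes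
-- at most 2 values if r ≠ s (where r y ≠ s y it must equal r y or s y), at most k if r = s.
-- Hence E (m + 1) ≤ 2 E m + j, so E m + j ≤ (j + 1) 2^m, and multiplying over the vertices gives
-- c(n, k) ≤ (k - 1)^n 2^(n choose 2).
module Submission where

open import Defs
open import Data.Nat using (ℕ; zero; suc; _+_; _≤_; _∸_; _*_; _^_; z≤n; s≤s)
open import Data.Nat.Combinatorics using (_C_; nC1≡n; nCk+nC[k+1]≡[n+1]C[k+1])

open import Level using (Level)
open import Function using (_∘_; id)
open import Data.Nat.Properties
  using (≤-refl; ≤-trans; ≤-reflexive; +-mono-≤; +-monoˡ-≤; *-monoʳ-≤; *-monoˡ-≤; m≤m+n;
         +-assoc; *-identityʳ; ^-distribˡ-+-*; module ≤-Reasoning)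
open import Data.Nat.Tactic.RingSolver using (solve-∀)
open import Data.Fin using (Fin; zero; suc; _≟_)
open import Data.Fin.Properties using (suc-injective; 0≢1+n; all?; ¬∀⟶∃¬; injective⇒≤)
open import Data.Maybe using (Maybe; just; nothing; fromMaybe)
open import Data.Maybe.Properties using (just-injective)
open import Data.Vec using (Vec; []; _∷_; lookup; tabulate)
open import Data.Vec.Properties using (∷-injective; lookup∘tabulate; tabulate∘lookup; tabulate-cong)
import Data.Vec.Properties as Vec
open import Data.Vec.Relation.Binary.Pointwise.Extensional using (ext; Pointwise-≡⇒≡)
open import Data.List as List using (List; []; _∷_; map; concatMap; filter; length; _++_)
open import Data.List.Properties using (length-++; length-map; length-filter; map-tabulate; length-tabulate)
open import Data.List.Membership.Propositional using (_∈_)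
open import Data.List.Membership.Propositional.Properties
  using (∈-map⁺; ∈-map⁻; ∈-filter⁺; ∈-filter⁻; ∈-concat⁺′; ∈-lookup; ∈-tabulate⁺)
open import Data.List.Relation.Unary.Any using (here; there; index)
open import Data.List.Relation.Unary.Any.Properties using (lookup-index)
open import Data.List.Relation.Unary.All as All using ([]; _∷_)
import Data.List.Relation.Unary.All.Properties as All
open import Data.List.Relation.Unary.AllPairs using ([]; _∷_)
import Data.List.Relation.Unary.AllPairs as AllPairs
import Data.List.Relation.Unary.AllPairs.Properties as AllPairs
open import Data.List.Relation.Unary.Unique.Propositional using (Unique)
import Data.List.Relation.Unary.Unique.Propositional.Properties as Unique
open import Data.List.Relation.Binary.Subset.Propositional using (_⊆_)
open import Data.List.Relation.Binary.Disjoint.Propositional using (Disjoint)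
open import Data.Product using (_×_; _,_; proj₁; proj₂; swap)
open import Data.Unit using (⊤; tt)
open import Relation.Binary.Definitions using (DecidableEquality)
open import Relation.Binary.PropositionalEquality
  using (_≡_; _≢_; refl; sym; trans; cong; subst; ≢-sym; module ≡-Reasoning)
open import Relation.Nullary using (¬_; Dec; yes; no; contradiction)
open import Relation.Nullary.Decidable using (_×-dec_; ¬?)

private
  variable
    a b d : Level
    A : Set a
    B : Set b
    D : Set d
    j k m n : ℕ

Unique⇒lookup-injective : {xs : List A} → Unique xs →
  ∀ {i j} → List.lookup xs i ≡ List.lookup xs j → i ≡ j
Unique⇒lookup-injective (_ ∷ _) {zero} {zero} _ = refl
Unique⇒lookup-injective (x≢xs ∷ _) {zero} {suc j} eq = contradiction eq (All.lookup x≢xs (∈-lookup j))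
Unique⇒lookup-injective (x≢xs ∷ _) {suc i} {zero} eq = contradiction (sym eq) (All.lookup x≢xs (∈-lookup i))
Unique⇒lookup-injective (_ ∷ xs!) {suc i} {suc j} eq = cong suc (Unique⇒lookup-injective xs! eq)

Unique-⊆⇒length-≤ : {xs ys : List A} → Unique xs → xs ⊆ ys → length xs ≤ length ys
Unique-⊆⇒length-≤ {xs = xs} {ys} xs! xs⊆ys = injective⇒≤ {f = position} position-injective
  where
  position : Fin (length xs) → Fin (length ys)
  position i = index (xs⊆ys (∈-lookup i))

  position-injective : ∀ {i j} → position i ≡ position j → i ≡ j
  position-injective {i} {j} eq = Unique⇒lookup-injective xs! (begin
    List.lookup xs i            ≡⟨ lookup-index (xs⊆ys (∈-lookup i)) ⟩
    List.lookup ys (position i) ≡⟨ cong (List.lookup ys) eq ⟩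
    List.lookup ys (position j) ≡⟨ lookup-index (xs⊆ys (∈-lookup j)) ⟨
    List.lookup xs j            ∎)
    where open ≡-Reasoning

Unique-concatMap-map : {xs : List A} (f : A → List B) (g : A → B → D) →
  (∀ {x y u v} → g x u ≡ g y v → x ≡ y × u ≡ v) →
  Unique xs → (∀ x → Unique (f x)) → Unique (concatMap (λ x → map (g x) (f x)) xs)
Unique-concatMap-map f g g-injective xs! f! =
  Unique.concat⁺
    (All.map⁺ (All.tabulate λ {x} _ → Unique.map⁺ (proj₂ ∘ g-injective) (f! x)))
    (AllPairs.map⁺ (AllPairs.map disjoint xs!))
  where
  disjoint : ∀ {x y} → x ≢ y → Disjoint (map (g x) (f x)) (map (g y) (f y))
  disjoint x≢y (p , q) with ∈-map⁻ (g _) p | ∈-map⁻ (g _) q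
  ... | _ , _ , refl | _ , _ , eq = x≢y (proj₁ (g-injective eq))

length-concatMap-≤ : {xs : List A} (f : A → List B) {b : ℕ} →
  (∀ {x} → x ∈ xs → length (f x) ≤ b) → length (concatMap f xs) ≤ length xs * b
length-concatMap-≤ {xs = []} f _ = z≤n
length-concatMap-≤ {xs = x ∷ xs} f {b} bound = begin
  length (f x ++ concatMap f xs)         ≡⟨ length-++ (f x) ⟩
  length (f x) + length (concatMap f xs) ≤⟨ +-mono-≤ (bound (here refl)) (length-concatMap-≤ f (bound ∘ there)) ⟩
  b + length xs * b                      ∎
  where open ≤-Reasoning

length-concatMap-≤-except : DecidableEquality A → {xs : List A} (f : A → List B) (s : A) {b c : ℕ} →
  Unique xs → (∀ x → x ≢ s → length (f x) ≤ b) → length (f s) ≤ b + c →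
  length (concatMap f xs) ≤ length xs * b + c
length-concatMap-≤-except _≟_ {[]} f s _ _ _ = z≤n
length-concatMap-≤-except _≟_ {x ∷ xs} f s {b} {c} (x≢xs ∷ xs!) bound bound-s with x ≟ s
... | yes refl = begin
  length (f x ++ concatMap f xs)         ≡⟨ length-++ (f x) ⟩
  length (f x) + length (concatMap f xs) ≤⟨ +-mono-≤ bound-s (length-concatMap-≤ f λ y∈xs →
                                             bound _ (≢-sym (All.lookup x≢xs y∈xs))) ⟩
  b + c + length xs * b                  ≡⟨ rearrange b c (length xs) ⟩
  b + length xs * b + c                  ∎
  where
  open ≤-Reasoning
  rearrange : ∀ b c l → b + c + l * b ≡ b + l * b + c
  rearrange = solve-∀
... | no x≢s = begin
  length (f x ++ concatMap f xs)         ≡⟨ length-++ (f x) ⟩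
  length (f x) + length (concatMap f xs) ≤⟨ +-mono-≤ (bound x x≢s) (length-concatMap-≤-except _≟_ f s xs! bound bound-s) ⟩
  b + (length xs * b + c)                ≡⟨ +-assoc b _ c ⟨
  b + length xs * b + c                  ∎
  where open ≤-Reasoning

allFin≡tabulate : ∀ k → allFin k ≡ List.allFin k
allFin≡tabulate zero = refl
allFin≡tabulate (suc k) = cong (zero ∷_) (trans (cong (map suc) (allFin≡tabulate k)) (map-tabulate id suc))

∈-allFin : (x : Fin k) → x ∈ allFin k
∈-allFin {k} x rewrite allFin≡tabulate k = ∈-tabulate⁺ x

Unique-allFin : ∀ k → Unique (allFin k)
Unique-allFin k rewrite allFin≡tabulate k = Unique.allFin⁺ k

length-allFin : ∀ k → length (allFin k) ≡ k
length-allFin k rewrite allFin≡tabulate k = length-tabulate id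

Unique-allMaybeFin : ∀ k → Unique (allMaybeFin k)
Unique-allMaybeFin k =
  All.map⁺ (All.universal (λ _ ()) (allFin k)) ∷ Unique.map⁺ just-injective (Unique-allFin k)

Unique-allVecs : {xs : List A} → Unique xs → ∀ m → Unique (allVecs xs m)
Unique-allVecs xs! zero = [] ∷ []
Unique-allVecs {xs = xs} xs! (suc m) =
  Unique-concatMap-map (λ _ → allVecs xs m) _∷_ ∷-injective xs! (λ _ → Unique-allVecs xs! m)

Unique-allMatrices : ∀ n k → Unique (allMatrices n k)
Unique-allMatrices n k = Unique-allVecs (Unique-allVecs (Unique-allMaybeFin k) n) n

Distinct₃ : A → A → A → Set _
Distinct₃ x y z = (x ≢ y) × (y ≢ z) × (x ≢ z)

distinct₃? : DecidableEquality A → ∀ (x y z : A) → Dec (Distinct₃ x y z)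
distinct₃? _≟_ x y z = ¬? (x ≟ y) ×-dec ¬? (y ≟ z) ×-dec ¬? (x ≟ z)

Distinct₃-map : {f : A → B} → (∀ {x y} → f x ≡ f y → x ≡ y) →
  ∀ {x y z} → Distinct₃ x y z → Distinct₃ (f x) (f y) (f z)
Distinct₃-map f-injective (x≢y , y≢z , x≢z) = x≢y ∘ f-injective , y≢z ∘ f-injective , x≢z ∘ f-injective

Distinct₃-cong : {x x′ y y′ z z′ : A} → x ≡ x′ → y ≡ y′ → z ≡ z′ → Distinct₃ x y z → Distinct₃ x′ y′ z′
Distinct₃-cong refl refl refl d = d

¬Distinct₃⇒∈ : DecidableEquality A → {x y z : A} → ¬ Distinct₃ x y z → y ≢ z → x ∈ y ∷ z ∷ []
¬Distinct₃⇒∈ _≟_ {x} {y} {z} ¬d y≢z with x ≟ y | x ≟ z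
... | yes x≡y | _       = here x≡y
... | no _    | yes x≡z = there (here x≡z)
... | no x≢y  | no x≢z  = contradiction (x≢y , y≢z , x≢z) ¬d

RainbowFree : (Fin n → Fin n → D) → Set _
RainbowFree c = ∀ x y z → Distinct₃ x y z → ¬ Distinct₃ (c x y) (c y z) (c x z)

RainbowFree-resp : {c c′ : Fin n → Fin n → D} → (∀ i j → c i j ≡ c′ i j) → RainbowFree c → RainbowFree c′
RainbowFree-resp c≗c′ rainbowFree x y z d =
  rainbowFree x y z d ∘ Distinct₃-cong (sym (c≗c′ x y)) (sym (c≗c′ y z)) (sym (c≗c′ x z))

IsGallai⇒RainbowFree : {M : Matrix n k} → IsGallai M → RainbowFree (col M)
IsGallai⇒RainbowFree gallai x y z (x≢y , y≢z , x≢z) (p , q , r) = gallai x y z (x≢y , y≢z , x≢z , p , q , r)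

ColourFn : ℕ → ℕ → Set
ColourFn n k = Fin n → Fin n → Maybe (Fin k)

-- IsEdgeColouring M unfolds to IsEdgeColourFn (col M), and IsGallai M to RainbowFree (col M)
-- up to the bracketing of the product.
IsEdgeColourFn : ColourFn n k → Set
IsEdgeColourFn {n} c =
  ∀ (i j : Fin n) → (c i j ≡ c j i) × ((i ≡ j → c i j ≡ nothing) × (c i j ≡ nothing → i ≡ j))

dropVertex₀ : ColourFn (suc n) k → ColourFn n k
dropVertex₀ c x y = c (suc x) (suc y)

IsEdgeColourFn-dropVertex₀ : {c : ColourFn (suc n) k} → IsEdgeColourFn c → IsEdgeColourFn (dropVertex₀ c)
IsEdgeColourFn-dropVertex₀ edge i j with edge (suc i) (suc j)
... | symmetric , diagonal , offDiagonal = symmetric , diagonal ∘ cong suc , suc-injective ∘ offDiagonal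

-- Colouring k n stores a colouring of K_n vertex by vertex: vertex 0 carries the colours of its
-- edges to 1, …, n-1, and the rest is a colouring of the vertices 1, …, n-1.
Colouring : ℕ → ℕ → Set
Colouring k zero = ⊤
Colouring k (suc n) = Colouring k n × Vec (Fin k) n

colour : Colouring k n → ColourFn n k
colour {n = suc n} (T , r) zero    zero    = nothing
colour {n = suc n} (T , r) zero    (suc y) = just (lookup r y)
colour {n = suc n} (T , r) (suc x) zero    = just (lookup r x)
colour {n = suc n} (T , r) (suc x) (suc y) = colour T x y

decode : Colouring k n → Matrix n k
decode T = tabulate λ i → tabulate (colour T i)

encode : ColourFn n (suc k) → Colouring (suc k) n
encode {zero} c = tt
encode {suc n} c = encode (dropVertex₀ c) , tabulate λ y → fromMaybe zero (c zero (suc y))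

just-fromMaybe : {d : A} {x : Maybe A} → x ≢ nothing → just (fromMaybe d x) ≡ x
just-fromMaybe {x = just _} _ = refl
just-fromMaybe {x = nothing} x≢nothing = contradiction refl x≢nothing

colour-encode : {c : ColourFn n (suc k)} → IsEdgeColourFn c → ∀ i j → colour (encode c) i j ≡ c i j
colour-encode {suc n} edge zero zero = sym (proj₁ (proj₂ (edge zero zero)) refl)
colour-encode {suc n} {c = c} edge zero (suc y) = begin
  just (lookup (tabulate λ y → fromMaybe zero (c zero (suc y))) y) ≡⟨ cong just (lookup∘tabulate _ y) ⟩
  just (fromMaybe zero (c zero (suc y)))                          ≡⟨ just-fromMaybe (0≢1+n ∘ proj₂ (proj₂ (edge zero (suc y)))) ⟩
  c zero (suc y)                                                  ∎
  where open ≡-Reasoning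
colour-encode {suc n} edge (suc x) zero = trans (colour-encode edge zero (suc x)) (proj₁ (edge zero (suc x)))
colour-encode {suc n} edge (suc x) (suc y) = colour-encode (IsEdgeColourFn-dropVertex₀ edge) x y

≡-decode : {M : Matrix n k} {T : Colouring k n} → (∀ i j → col M i j ≡ colour T i j) → M ≡ decode T
≡-decode {M = M} {T} col≗colour = begin
  M                   ≡⟨ tabulate∘lookup M ⟨
  tabulate (lookup M) ≡⟨ tabulate-cong (λ i → trans (sym (tabulate∘lookup (lookup M i))) (tabulate-cong (col≗colour i))) ⟩
  decode T            ∎
  where open ≡-Reasoning

-- A row a ∷ r for a new vertex ★ placed in front of (T , s) colours ★0 with a and the edges from ★
-- to the vertices of T with r, while s colours the edges from 0 to them; a is admissible when no
-- triangle ★ 0 y is rainbow.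
Admissible : Fin k → Vec (Fin k) m → Vec (Fin k) m → Set
Admissible a r s = ∀ y → ¬ Distinct₃ a (lookup s y) (lookup r y)

admissible? : ∀ (a : Fin k) (r s : Vec (Fin k) m) → Dec (Admissible a r s)
admissible? a r s = all? λ y → ¬? (distinct₃? _≟_ a (lookup s y) (lookup r y))

admissibleColours : Vec (Fin k) m → Vec (Fin k) m → List (Fin k)
admissibleColours r s = filter (λ a → admissible? a r s) (allFin _)

extensions : Colouring k m → List (Vec (Fin k) m)
extensions {m = zero} _ = [] ∷ []
extensions {m = suc m} (T , s) = concatMap (λ r → map (_∷ r) (admissibleColours r s)) (extensions T)

gallaiColourings : ∀ k n → List (Colouring k n)
gallaiColourings k zero = tt ∷ []
gallaiColourings k (suc n) = concatMap (λ T → map (T ,_) (extensions T)) (gallaiColourings k n)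

Compatible : Colouring k m → Vec (Fin k) m → Set
Compatible T v = ∀ x y → x ≢ y → ¬ Distinct₃ (just (lookup v x)) (colour T x y) (just (lookup v y))

Compatible⇒∈extensions : (T : Colouring k m) (v : Vec (Fin k) m) → Compatible T v → v ∈ extensions T
Compatible⇒∈extensions {m = zero} _ [] _ = here refl
Compatible⇒∈extensions {m = suc m} (T , s) (a ∷ r) compatible =
  ∈-concat⁺′ (∈-map⁺ (_∷ r) a-admissible) (∈-map⁺ (λ r → map (_∷ r) (admissibleColours r s)) r-extends)
  where
  r-extends : r ∈ extensions T
  r-extends = Compatible⇒∈extensions T r λ x y x≢y → compatible (suc x) (suc y) (x≢y ∘ suc-injective)

  a-admissible : a ∈ admissibleColours r s
  a-admissible = ∈-filter⁺ (λ a → admissible? a r s) (∈-allFin a)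
    λ y → compatible zero (suc y) (λ ()) ∘ Distinct₃-map just-injective

RainbowFree⇒∈gallaiColourings : (T : Colouring k n) → RainbowFree (colour T) → T ∈ gallaiColourings k n
RainbowFree⇒∈gallaiColourings {n = zero} _ _ = here refl
RainbowFree⇒∈gallaiColourings {k} {suc n} (T , s) rainbowFree =
  ∈-concat⁺′ (∈-map⁺ (T ,_) s-extends) (∈-map⁺ (λ T → map (T ,_) (extensions T)) T-gallai)
  where
  T-gallai : T ∈ gallaiColourings k n
  T-gallai = RainbowFree⇒∈gallaiColourings T λ x y z →
    rainbowFree (suc x) (suc y) (suc z) ∘ Distinct₃-map suc-injective

  s-extends : s ∈ extensions T
  s-extends = Compatible⇒∈extensions T s λ x y x≢y →
    rainbowFree zero (suc x) (suc y) ((λ ()) , x≢y ∘ suc-injective , (λ ()))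

IsGallaiColouring⇒∈decoded : {M : Matrix n (suc k)} → IsGallaiColouring M →
  M ∈ map decode (gallaiColourings (suc k) n)
IsGallaiColouring⇒∈decoded {M = M} (edge , gallai) =
  subst (_∈ map decode _) (sym M≡decoded) (∈-map⁺ decode encoding-gallai)
  where
  col≗colour : ∀ i j → col M i j ≡ colour (encode (col M)) i j
  col≗colour i j = sym (colour-encode edge i j)

  M≡decoded : M ≡ decode (encode (col M))
  M≡decoded = ≡-decode col≗colour

  encoding-gallai : encode (col M) ∈ gallaiColourings _ _
  encoding-gallai = RainbowFree⇒∈gallaiColourings _ (RainbowFree-resp col≗colour (IsGallai⇒RainbowFree {M = M} gallai))

Unique-extensions : (T : Colouring k m) → Unique (extensions T)
Unique-extensions {m = zero} _ = [] ∷ []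
Unique-extensions {m = suc m} (T , s) =
  Unique-concatMap-map (λ r → admissibleColours r s) (λ r a → a ∷ r) (swap ∘ ∷-injective)
    (Unique-extensions T) (λ r → Unique.filter⁺ (λ a → admissible? a r s) (Unique-allFin _))

length-admissibleColours : (r s : Vec (Fin k) m) → length (admissibleColours r s) ≤ k
length-admissibleColours {k} r s =
  ≤-trans (length-filter (λ a → admissible? a r s) (allFin k)) (≤-reflexive (length-allFin k))

length-admissibleColours-≢ : {r s : Vec (Fin k) m} → r ≢ s → length (admissibleColours r s) ≤ 2
length-admissibleColours-≢ {r = r} {s} r≢s
  with ¬∀⟶∃¬ _ (λ y → lookup r y ≡ lookup s y) (λ y → lookup r y ≟ lookup s y) (r≢s ∘ Pointwise-≡⇒≡ ∘ ext)
... | y , ry≢sy =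
  Unique-⊆⇒length-≤ (Unique.filter⁺ (λ a → admissible? a r s) (Unique-allFin _))
    λ a∈ → ¬Distinct₃⇒∈ _≟_ (proj₂ (∈-filter⁻ (λ a → admissible? a r s) {xs = allFin _} a∈) y) (≢-sym ry≢sy)

length-extensions-step : (T : Colouring (2 + j) m) (s : Vec (Fin (2 + j)) m) →
  length (extensions (T , s)) ≤ length (extensions T) * 2 + j
length-extensions-step T s =
  length-concatMap-≤-except (Vec.≡-dec _≟_) (λ r → map (_∷ r) (admissibleColours r s)) s (Unique-extensions T)
    (λ r r≢s → ≤-trans (≤-reflexive (length-map _ (admissibleColours r s))) (length-admissibleColours-≢ r≢s))
    (≤-trans (≤-reflexive (length-map _ (admissibleColours s s))) (length-admissibleColours s s))

length-extensions : (T : Colouring (2 + j) m) → length (extensions T) + j ≤ suc j * 2 ^ m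
length-extensions {j} {zero} _ = ≤-reflexive (sym (*-identityʳ (suc j)))
length-extensions {j} {suc m} (T , s) = begin
  length (extensions (T , s)) + j   ≤⟨ +-monoˡ-≤ j (length-extensions-step T s) ⟩
  length (extensions T) * 2 + j + j ≡⟨ double (length (extensions T)) j ⟩
  2 * (length (extensions T) + j)   ≤⟨ *-monoʳ-≤ 2 (length-extensions T) ⟩
  2 * (suc j * 2 ^ m)               ≡⟨ shuffle (suc j) (2 ^ m) ⟩
  suc j * 2 ^ suc m                 ∎
  where
  open ≤-Reasoning
  double : ∀ l j → l * 2 + j + j ≡ 2 * (l + j)
  double = solve-∀
  shuffle : ∀ a p → 2 * (a * p) ≡ a * (2 * p)
  shuffle = solve-∀

suc-C-2 : ∀ n → suc n C 2 ≡ n + n C 2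
suc-C-2 n = trans (sym (nCk+nC[k+1]≡[n+1]C[k+1] n 1)) (cong (_+ n C 2) (nC1≡n n))

length-gallaiColourings : ∀ j n → length (gallaiColourings (2 + j) n) ≤ suc j ^ n * 2 ^ (n C 2)
length-gallaiColourings j zero = ≤-refl
length-gallaiColourings j (suc n) = begin
  length (gallaiColourings (2 + j) (suc n))         ≤⟨ length-concatMap-≤ _ row-bound ⟩
  length (gallaiColourings (2 + j) n) * (suc j * 2 ^ n)
                                                    ≤⟨ *-monoˡ-≤ _ (length-gallaiColourings j n) ⟩
  suc j ^ n * 2 ^ (n C 2) * (suc j * 2 ^ n)         ≡⟨ shuffle (suc j ^ n) (2 ^ (n C 2)) (suc j) (2 ^ n) ⟩
  suc j ^ suc n * (2 ^ n * 2 ^ (n C 2))             ≡⟨ cong (suc j ^ suc n *_) (^-distribˡ-+-* 2 n (n C 2)) ⟨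
  suc j ^ suc n * 2 ^ (n + n C 2)                   ≡⟨ cong (λ e → suc j ^ suc n * 2 ^ e) (suc-C-2 n) ⟨
  suc j ^ suc n * 2 ^ (suc n C 2)                   ∎
  where
  open ≤-Reasoning
  row-bound : ∀ {T} → T ∈ gallaiColourings (2 + j) n → length (map (T ,_) (extensions T)) ≤ suc j * 2 ^ n
  row-bound {T} _ = ≤-trans (≤-reflexive (length-map (T ,_) (extensions T)))
                      (≤-trans (m≤m+n _ j) (length-extensions T))
  shuffle : ∀ a p s q → a * p * (s * q) ≡ s * a * (q * p)
  shuffle = solve-∀

-- The bound holds for every n.
corollary2p4 : ∀ (n k : ℕ) → 2 ≤ n → 2 ≤ k →
    gallaiCount n k ≤ (k ∸ 1) ^ n * 2 ^ (n C 2)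
corollary2p4 n 1 _ (s≤s ())
corollary2p4 n (suc (suc j)) _ _ = begin
  gallaiCount n (2 + j)                         ≤⟨ Unique-⊆⇒length-≤ gallai-unique gallai⊆decoded ⟩
  length (map decode (gallaiColourings (2 + j) n)) ≡⟨ length-map decode (gallaiColourings (2 + j) n) ⟩
  length (gallaiColourings (2 + j) n)           ≤⟨ length-gallaiColourings j n ⟩
  suc j ^ n * 2 ^ (n C 2)                       ∎
  where
  open ≤-Reasoning
  gallai-unique : Unique (filter isGallaiColouring? (allMatrices n (2 + j)))
  gallai-unique = Unique.filter⁺ isGallaiColouring? (Unique-allMatrices n (2 + j))
  gallai⊆decoded : filter isGallaiColouring? (allMatrices n (2 + j)) ⊆ map decode (gallaiColourings (2 + j) n)
  gallai⊆decoded M∈ = IsGallaiColouring⇒∈decoded (proj₂ (∈-filter⁻ isGallaiColouring? {xs = allMatrices n (2 + j)} M∈))
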